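{- Let $n\ge 5$ and let $g_0$ be the smallest positive integer such that $2^{g_0}+1>n-g_0$. Then for every integer $k$ with $1\le k\le g_0-2$, there is an integer $\alpha\ge 0$ such that the vertex $n-g_0-\alpha$ belongs to the subtree core $S_c(P_{n-g_0+k,\,g_0-k})$.
   Context: The path-star tree $P_{m,g}$ on $n=m+g$ vertices is obtained by identifying the center of the star $K_{1,g}$ with a pendant vertex of the path $P_m$; its vertices are labelled so that the path is $1,2,\dots,m$ (vertex $m$ being the star center) and the pendant vertices of the star are $m+1,\dots,n$. For a tree $T$ and $v\in V(T)$, $f_T(v)$ is the number of subtrees of $T$ containing $v$, and the subtree core $S_c(T)$ is the set of vertices at which $f_T$ is maximal. -}

module Defs where

open import Data.Nat using (ℕ; zero; suc; _+_; _∸_; _≤_; _<_; _^_; _≡ᵇ_; _<ᵇ_)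
open import Data.Product using (_×_)
open import Data.Bool using (Bool; true; false; _∧_; _∨_; not; T)
open import Data.Fin using (Fin; toℕ)
open import Data.Vec using (Vec; []; _∷_; lookup; tabulate)
open import Data.List using (List; []; _∷_; _++_; map; length; filterᵇ; allFin)
open import Data.Bool.ListAction using (or)

Graph : ℕ → Set
Graph n = Fin n → Fin n → Bool

-- Path-star tree P_{m, n-m} on n vertices.  Vertex with 0-based index i
-- is the paper's vertex i+1.  Path: 1,2,...,m (indices 0..m-1); the star
-- centre is vertex m (index m-1); pendant vertices m+1..n (indices m..n-1).
pathStar : (n m : ℕ) → Graph n
pathStar n m i j =
  (((suc a ≡ᵇ b) ∨ (suc b ≡ᵇ a)) ∧ (a <ᵇ m) ∧ (b <ᵇ m))
  ∨ ((a ≡ᵇ (m ∸ 1)) ∧ ((m ∸ 1) <ᵇ b))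
  ∨ ((b ≡ᵇ (m ∸ 1)) ∧ ((m ∸ 1) <ᵇ a))
  where
  a = toℕ i
  b = toℕ j

VSet : ℕ → Set
VSet n = Vec Bool n

allSubsets : (n : ℕ) → List (VSet n)
allSubsets zero = [] ∷ []
allSubsets (suc n) = map (true ∷_) (allSubsets n) ++ map (false ∷_) (allSubsets n)

step : {n : ℕ} → Graph n → VSet n → VSet n → VSet n
step {n} G S R = tabulate λ w →
  lookup S w ∧ (lookup R w ∨ or (map (λ x → lookup R x ∧ G x w) (allFin n)))

iter : {A : Set} → ℕ → (A → A) → A → A
iter zero f a = a
iter (suc k) f a = f (iter k f a)

-- Vertices reachable from v by walks staying inside S (n steps suffice).
reach : {n : ℕ} → Graph n → VSet n → Fin n → VSet n
reach {n} G S v = iter n (step G S) (tabulate λ w → lookup S w ∧ (toℕ w ≡ᵇ toℕ v))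

sameSet : {n : ℕ} → VSet n → VSet n → Bool
sameSet [] [] = true
sameSet (x ∷ xs) (y ∷ ys) = ((x ∧ y) ∨ (not x ∧ not y)) ∧ sameSet xs ys

-- In a tree, subtrees are exactly the connected induced subgraphs.
isSubtreeAt : {n : ℕ} → Graph n → Fin n → VSet n → Bool
isSubtreeAt G v S = lookup S v ∧ sameSet (reach G S v) S

f : {n : ℕ} → Graph n → Fin n → ℕ
f {n} G v = length (filterᵇ (isSubtreeAt G v) (allSubsets n))

InSubtreeCore : {n : ℕ} → Graph n → Fin n → Set
InSubtreeCore {n} G v = (w : Fin n) → f G w ≤ f G v

IsG0 : ℕ → ℕ → Set
IsG0 n g0 = (1 ≤ g0) × (n ∸ g0 < 2 ^ g0 + 1)
          × ((g : ℕ) → 1 ≤ g → g < g0 → 2 ^ g + 1 ≤ n ∸ g)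

module Submission where

-- Write the path-star tree as P_{c+1,g} with 0-based vertices: path 0,…,c,
-- centre c, pendants c+1,…,c+g.  A subtree through the path vertex V is a
-- path interval [a,b] ∋ V, plus any set of pendants when b = c, so
-- f(V) = (V+1)·((c∸V) + 2^g); a subtree through a pendant is the pendant
-- alone or contains the centre, so f(pendant) ≤ (c+1)·2^(g-1) + 1.
-- Subtrees are Boolean vectors: we count the vectors accepted by recursive
-- recognizers of these shapes, show that every subtree is accepted (a
-- missing path vertex separates the tree) and, at path vertices, that every
-- accepted vector is a subtree (reachability).  The two factors of f(V) sum
-- to c+1+2^g, so the balanced path vertex maximises f and also beats the
-- pendants.  For c+1 = n-g0+k and g = g0-k, minimality of g0 gives
-- k-1 + 2^g ≤ n-g0, which puts the balanced vertex left of n-g0.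

open import Defs
open import Data.Nat
open import Data.Nat.Properties
open import Data.Nat.Tactic.RingSolver using (solve-∀)
open import Data.Bool using (Bool; true; false; _∧_; _∨_; T; if_then_else_)
open import Data.Bool.Properties using (T-∧; T-∨; ∧-conicalˡ; ∧-conicalʳ; ∨-zeroʳ)
open import Data.Bool.ListAction using (or)
open import Data.Fin using (Fin; toℕ; fromℕ<) renaming (zero to fzero; suc to fsuc)
open import Data.Fin.Properties using (toℕ-injective; toℕ-fromℕ<; toℕ<n)
open import Data.Vec using (Vec; []; _∷_; lookup; tabulate)
open import Data.Vec.Properties using (lookup∘tabulate)
open import Data.List using (List; []; _∷_; _++_; map; length; filterᵇ; allFin)
open import Data.List.Properties using (length-++; filter-++)
open import Data.List.Membership.Propositional using (_∈_)
open import Data.List.Membership.Propositional.Properties using (∈-allFin)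
open import Data.List.Relation.Unary.Any using (here; there)
open import Data.Product using (Σ; ∃; _×_; _,_; proj₁; proj₂)
open import Data.Sum using (_⊎_; inj₁; inj₂)
open import Data.Empty using (⊥; ⊥-elim)
open import Function.Bundles using (Equivalence)
open import Relation.Nullary using (¬_; yes; no)
open import Relation.Nullary.Decidable using (T?)
open import Relation.Binary.Definitions using (tri<; tri≈; tri>)
open import Relation.Binary.PropositionalEquality

count : (k : ℕ) → (Vec Bool k → Bool) → ℕ
count k p = length (filterᵇ p (allSubsets k))

length-filterᵇ-∷ : ∀ {A : Set} (p : A → Bool) x xs →
  length (filterᵇ p (x ∷ xs)) ≡ (if p x then 1 else 0) + length (filterᵇ p xs)
length-filterᵇ-∷ p x xs with p x
... | true  = refl
... | false = refl

length-filterᵇ-map : ∀ {A B : Set} (p : B → Bool) (h : A → B) xs →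
  length (filterᵇ p (map h xs)) ≡ length (filterᵇ (λ a → p (h a)) xs)
length-filterᵇ-map p h [] = refl
length-filterᵇ-map p h (x ∷ xs)
  rewrite length-filterᵇ-∷ p (h x) (map h xs) | length-filterᵇ-∷ (λ a → p (h a)) x xs
        | length-filterᵇ-map p h xs = refl

length-filterᵇ-mono : ∀ {A : Set} (p q : A → Bool) → (∀ a → p a ≡ true → q a ≡ true) →
  ∀ xs → length (filterᵇ p xs) ≤ length (filterᵇ q xs)
length-filterᵇ-mono p q p⇒q [] = ≤-refl
length-filterᵇ-mono p q p⇒q (x ∷ xs)
  rewrite length-filterᵇ-∷ p x xs | length-filterᵇ-∷ q x xs with p x in px
... | true rewrite p⇒q x px = s≤s (length-filterᵇ-mono p q p⇒q xs)
... | false = m≤n⇒m≤o+n (if q x then 1 else 0) (length-filterᵇ-mono p q p⇒q xs)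

length-filterᵇ-none : ∀ {A : Set} (xs : List A) → length (filterᵇ (λ _ → false) xs) ≡ 0
length-filterᵇ-none [] = refl
length-filterᵇ-none (x ∷ xs) = length-filterᵇ-none xs

count-split : ∀ k p → count (suc k) p ≡ count k (λ xs → p (true ∷ xs)) + count k (λ xs → p (false ∷ xs))
count-split k p = begin
  length (filterᵇ p (map (true ∷_) S ++ map (false ∷_) S))
    ≡⟨ cong length (filter-++ (λ x → T? (p x)) (map (true ∷_) S) (map (false ∷_) S)) ⟩
  length (filterᵇ p (map (true ∷_) S) ++ filterᵇ p (map (false ∷_) S))
    ≡⟨ length-++ (filterᵇ p (map (true ∷_) S)) ⟩
  length (filterᵇ p (map (true ∷_) S)) + length (filterᵇ p (map (false ∷_) S))
    ≡⟨ cong₂ _+_ (length-filterᵇ-map p (true ∷_) S) (length-filterᵇ-map p (false ∷_) S) ⟩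
  count k (λ xs → p (true ∷ xs)) + count k (λ xs → p (false ∷ xs)) ∎
  where
  open ≡-Reasoning
  S : List (Vec Bool k)
  S = allSubsets k

count-mono : ∀ k p q → (∀ a → p a ≡ true → q a ≡ true) → count k p ≤ count k q
count-mono k p q p⇒q = length-filterᵇ-mono p q p⇒q (allSubsets k)

count-none : ∀ k → count k (λ _ → false) ≡ 0
count-none k = length-filterᵇ-none (allSubsets k)

-- Recognizers for the subtree shapes of a path-star tree.  Vectors are read
-- from vertex 0 onwards; a Boolean flag carries the membership of the
-- previously read vertex.

-- Pendant block: arbitrary if the centre is present, empty otherwise.
emptyUnless : ∀ {k} → Bool → Vec Bool k → Bool
emptyUnless centre [] = true
emptyUnless true (x ∷ xs) = emptyUnless true xs
emptyUnless false (true ∷ xs) = false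
emptyUnless false (false ∷ xs) = emptyUnless false xs

-- Right of the root: s further path vertices forming an initial segment,
-- then the pendant block; the flag is the membership of the current vertex.
rightArm : ∀ {k} → ℕ → Bool → Vec Bool k → Bool
rightArm zero cur xs = emptyUnless cur xs
rightArm (suc s) cur [] = true
rightArm (suc s) true (x ∷ xs) = rightArm s x xs
rightArm (suc s) false (true ∷ xs) = false
rightArm (suc s) false (false ∷ xs) = rightArm s false xs

-- Subtrees through the path vertex with r path vertices on its left and s on
-- its right: a final segment of the left part, the root, then a right arm.
pathShape : ∀ {k} → ℕ → Bool → ℕ → Vec Bool k → Bool
pathShape r prev s [] = false
pathShape zero prev s (true ∷ xs) = rightArm s true xs
pathShape zero prev s (false ∷ xs) = false
pathShape (suc r) true s (true ∷ xs) = pathShape r true s xs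
pathShape (suc r) true s (false ∷ xs) = false
pathShape (suc r) false s (x ∷ xs) = pathShape r x s xs

-- Pendant block containing the pendant at offset u: the other pendants are
-- arbitrary if the centre is present and absent otherwise.
leafBlock : ∀ {k} → Bool → ℕ → Vec Bool k → Bool
leafBlock centre u [] = false
leafBlock centre zero (true ∷ xs) = emptyUnless centre xs
leafBlock centre zero (false ∷ xs) = false
leafBlock true (suc u) (x ∷ xs) = leafBlock true u xs
leafBlock false (suc u) (true ∷ xs) = false
leafBlock false (suc u) (false ∷ xs) = leafBlock false u xs

-- Subtrees through a pendant: a final segment of the path (r+1 vertices
-- remain to be read), then a pendant block containing the pendant at offset u.
leafShape : ∀ {k} → ℕ → Bool → ℕ → Vec Bool k → Bool
leafShape r prev u [] = false
leafShape zero true u (true ∷ xs) = leafBlock true u xs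
leafShape zero true u (false ∷ xs) = false
leafShape zero false u (x ∷ xs) = leafBlock x u xs
leafShape (suc r) true u (true ∷ xs) = leafShape r true u xs
leafShape (suc r) true u (false ∷ xs) = false
leafShape (suc r) false u (x ∷ xs) = leafShape r x u xs

count-emptyUnless-true : ∀ q → count q (emptyUnless true) ≡ 2 ^ q
count-emptyUnless-true zero = refl
count-emptyUnless-true (suc q)
  rewrite count-split q (emptyUnless true) | count-emptyUnless-true q =
  cong (2 ^ q +_) (sym (+-identityʳ _))

count-emptyUnless-false : ∀ q → count q (emptyUnless false) ≡ 1
count-emptyUnless-false zero = refl
count-emptyUnless-false (suc q)
  rewrite count-split q (emptyUnless false) | count-none q = count-emptyUnless-false q

count-rightArm-true : ∀ s g → count (s + g) (rightArm s true) ≡ s + 2 ^ g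
count-rightArm-false : ∀ s g → count (s + g) (rightArm s false) ≡ 1
count-rightArm-true zero g = count-emptyUnless-true g
count-rightArm-true (suc s) g
  rewrite count-split (s + g) (rightArm (suc s) true)
        | count-rightArm-true s g | count-rightArm-false s g = +-comm (s + 2 ^ g) 1
count-rightArm-false zero g = count-emptyUnless-false g
count-rightArm-false (suc s) g
  rewrite count-split (s + g) (rightArm (suc s) false) | count-none (s + g) =
  count-rightArm-false s g

count-pathShape-true : ∀ r s g → count (suc r + (s + g)) (pathShape r true s) ≡ s + 2 ^ g
count-pathShape-true zero s g
  rewrite count-split (s + g) (pathShape zero true s) | count-none (s + g) =
  trans (+-identityʳ _) (count-rightArm-true s g)
count-pathShape-true (suc r) s g
  rewrite count-split (suc r + (s + g)) (pathShape (suc r) true s) | count-none (suc r + (s + g)) =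
  trans (+-identityʳ _) (count-pathShape-true r s g)

count-pathShape : ∀ r s g → count (suc r + (s + g)) (pathShape r false s) ≡ suc r * (s + 2 ^ g)
count-pathShape zero s g
  rewrite count-split (s + g) (pathShape zero false s) | count-none (s + g) =
  trans (+-identityʳ _) (trans (count-rightArm-true s g) (sym (+-identityʳ _)))
count-pathShape (suc r) s g
  rewrite count-split (suc r + (s + g)) (pathShape (suc r) false s)
        | count-pathShape-true r s g | count-pathShape r s g = refl

count-leafBlock-true : ∀ u q → count (suc u + q) (leafBlock true u) ≡ 2 ^ (u + q)
count-leafBlock-true zero q
  rewrite count-split q (leafBlock true zero) | count-none q =
  trans (+-identityʳ _) (count-emptyUnless-true q)
count-leafBlock-true (suc u) q
  rewrite count-split (suc u + q) (leafBlock true (suc u)) | count-leafBlock-true u q =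
  cong (2 ^ (u + q) +_) (sym (+-identityʳ _))

count-leafBlock-false : ∀ u q → count (suc u + q) (leafBlock false u) ≡ 1
count-leafBlock-false zero q
  rewrite count-split q (leafBlock false zero) | count-none q =
  trans (+-identityʳ _) (count-emptyUnless-false q)
count-leafBlock-false (suc u) q
  rewrite count-split (suc u + q) (leafBlock false (suc u)) | count-none (suc u + q) =
  count-leafBlock-false u q

count-leafShape-true : ∀ r u q → count (suc r + (suc u + q)) (leafShape r true u) ≡ 2 ^ (u + q)
count-leafShape-true zero u q
  rewrite count-split (suc u + q) (leafShape zero true u) | count-none (suc u + q) =
  trans (+-identityʳ _) (count-leafBlock-true u q)
count-leafShape-true (suc r) u q
  rewrite count-split (suc r + (suc u + q)) (leafShape (suc r) true u)
        | count-none (suc r + (suc u + q)) =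
  trans (+-identityʳ _) (count-leafShape-true r u q)

count-leafShape : ∀ r u q → count (suc r + (suc u + q)) (leafShape r false u) ≡ suc r * 2 ^ (u + q) + 1
count-leafShape zero u q
  rewrite count-split (suc u + q) (leafShape zero false u)
        | count-leafBlock-true u q | count-leafBlock-false u q =
  cong (_+ 1) (sym (+-identityʳ _))
count-leafShape (suc r) u q
  rewrite count-split (suc r + (suc u + q)) (leafShape (suc r) false u)
        | count-leafShape-true r u q | count-leafShape r u q =
  sym (+-assoc (2 ^ (u + q)) _ 1)

-- Membership of the vertex with index i (false beyond the end).
at : ∀ {k} → Vec Bool k → ℕ → Bool
at [] _ = false
at (x ∷ xs) zero = x
at (x ∷ xs) (suc i) = at xs i

true≢false : true ≡ false → ⊥
true≢false ()

emptyUnless-complete : ∀ {k} centre (xs : Vec Bool k) →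
  (∀ i → at xs i ≡ true → centre ≡ true) → emptyUnless centre xs ≡ true
emptyUnless-complete centre [] h = refl
emptyUnless-complete true (x ∷ xs) h = emptyUnless-complete true xs (λ i → h (suc i))
emptyUnless-complete false (true ∷ xs) h = h zero refl
emptyUnless-complete false (false ∷ xs) h = emptyUnless-complete false xs (λ i → h (suc i))

emptyUnless-sound : ∀ {k} centre (xs : Vec Bool k) →
  emptyUnless centre xs ≡ true → ∀ i → at xs i ≡ true → centre ≡ true
emptyUnless-sound true xs acc i x∈ = refl
emptyUnless-sound false (true ∷ xs) () i x∈
emptyUnless-sound false (false ∷ xs) acc zero ()
emptyUnless-sound false (false ∷ xs) acc (suc i) x∈ = emptyUnless-sound false xs acc i x∈

ArmSpec : ∀ {k} → ℕ → ℕ → Vec Bool k → Set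
ArmSpec o s y = (∀ i → suc i ≤ s → at y (o + suc i) ≡ true → at y (o + i) ≡ true)
              × (∀ i → s < i → at y (o + i) ≡ true → at y (o + s) ≡ true)

rightArm-complete : ∀ {k} s cur (xs : Vec Bool k) → ArmSpec 0 s (cur ∷ xs) → rightArm s cur xs ≡ true
rightArm-complete zero cur xs (_ , beyond) = emptyUnless-complete cur xs (λ i → beyond (suc i) (s≤s z≤n))
rightArm-complete (suc s) cur [] _ = refl
rightArm-complete (suc s) true (x ∷ xs) (seg , beyond) =
  rightArm-complete s x xs ((λ i le → seg (suc i) (s≤s le)) , (λ i lt → beyond (suc i) (s≤s lt)))
rightArm-complete (suc s) false (true ∷ xs) (seg , beyond) = ⊥-elim (true≢false (sym (seg zero (s≤s z≤n) refl)))
rightArm-complete (suc s) false (false ∷ xs) (seg , beyond) =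
  rightArm-complete s false xs ((λ i le → seg (suc i) (s≤s le)) , (λ i lt → beyond (suc i) (s≤s lt)))

rightArm-sound : ∀ {k} s cur (xs : Vec Bool k) → rightArm s cur xs ≡ true → ArmSpec 0 s (cur ∷ xs)
rightArm-sound zero cur xs acc = (λ i ()) , λ { zero () ; (suc i) lt x∈ → emptyUnless-sound cur xs acc i x∈ }
rightArm-sound (suc s) cur [] acc = (λ i le ()) , λ { zero () ; (suc i) lt () }
rightArm-sound (suc s) true (x ∷ xs) acc with rightArm-sound s x xs acc
... | (seg , beyond) = (λ { zero le x∈ → refl ; (suc i) (s≤s le) x∈ → seg i le x∈ })
                     , λ { zero () ; (suc i) (s≤s lt) x∈ → beyond i lt x∈ }
rightArm-sound (suc s) false (false ∷ xs) acc with rightArm-sound s false xs acc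
... | (seg , beyond) = (λ { zero le x∈ → x∈ ; (suc i) (s≤s le) x∈ → seg i le x∈ })
                     , λ { zero () ; (suc i) (s≤s lt) x∈ → beyond i lt x∈ }

-- Shape of a subtree through path vertex r, read with one extra (virtual)
-- vertex in front: a final segment up to index r+1, which is present,
-- followed by a right arm.
PathSpec : ∀ {k} → ℕ → ℕ → Vec Bool k → Set
PathSpec r s y = (∀ i → i ≤ r → at y i ≡ true → at y (suc i) ≡ true)
               × (at y (suc r) ≡ true) × ArmSpec (suc r) s y

pathShape-complete : ∀ {k} r prev s (xs : Vec Bool k) → PathSpec r s (prev ∷ xs) → pathShape r prev s xs ≡ true
pathShape-complete r prev s [] (_ , () , _)
pathShape-complete zero prev s (true ∷ xs) (_ , _ , arm) = rightArm-complete s true xs arm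
pathShape-complete zero prev s (false ∷ xs) (_ , () , _)
pathShape-complete (suc r) true s (true ∷ xs) (seg , root , arm) =
  pathShape-complete r true s xs ((λ i le → seg (suc i) (s≤s le)) , root , arm)
pathShape-complete (suc r) true s (false ∷ xs) (seg , root , arm) = ⊥-elim (true≢false (sym (seg zero z≤n refl)))
pathShape-complete (suc r) false s (x ∷ xs) (seg , root , arm) =
  pathShape-complete r x s xs ((λ i le → seg (suc i) (s≤s le)) , root , arm)

pathShape-sound : ∀ {k} r prev s (xs : Vec Bool k) → pathShape r prev s xs ≡ true → PathSpec r s (prev ∷ xs)
pathShape-sound zero prev s (true ∷ xs) acc = (λ { zero le x∈ → refl }) , refl , rightArm-sound s true xs acc
pathShape-sound (suc r) true s (true ∷ xs) acc with pathShape-sound r true s xs acc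
... | (seg , root , arm) = (λ { zero le _ → refl ; (suc i) (s≤s le) x∈ → seg i le x∈ }) , root , arm
pathShape-sound (suc r) false s (x ∷ xs) acc with pathShape-sound r x s xs acc
... | (seg , root , arm) = (λ { zero le () ; (suc i) (s≤s le) x∈ → seg i le x∈ }) , root , arm

BlockSpec : ∀ {k} → ℕ → ℕ → Vec Bool k → Set
BlockSpec o u y = (∀ i → ¬ i ≡ u → at y (o + suc i) ≡ true → at y o ≡ true) × (at y (o + suc u) ≡ true)

leafBlock-complete : ∀ {k} centre u (xs : Vec Bool k) → BlockSpec 0 u (centre ∷ xs) → leafBlock centre u xs ≡ true
leafBlock-complete centre u [] (_ , ())
leafBlock-complete centre zero (true ∷ xs) (others , _) = emptyUnless-complete centre xs (λ i → others (suc i) (λ ()))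
leafBlock-complete centre zero (false ∷ xs) (_ , ())
leafBlock-complete true (suc u) (x ∷ xs) (_ , leaf) = leafBlock-complete true u xs ((λ _ _ _ → refl) , leaf)
leafBlock-complete false (suc u) (true ∷ xs) (others , _) = ⊥-elim (true≢false (sym (others zero (λ ()) refl)))
leafBlock-complete false (suc u) (false ∷ xs) (others , leaf) =
  leafBlock-complete false u xs ((λ i i≢u → others (suc i) (λ e → i≢u (suc-injective e))) , leaf)

-- Shape of a subtree through a pendant: a final segment of the path
-- (indices up to r+1, read with a virtual vertex in front), then a block.
LeafSpec : ∀ {k} → ℕ → ℕ → Vec Bool k → Set
LeafSpec r u y = (∀ i → i ≤ r → at y i ≡ true → at y (suc i) ≡ true) × BlockSpec (suc r) u y

leafShape-complete : ∀ {k} r prev u (xs : Vec Bool k) → LeafSpec r u (prev ∷ xs) → leafShape r prev u xs ≡ true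
leafShape-complete r prev u [] (_ , _ , ())
leafShape-complete zero true u (true ∷ xs) (_ , block) = leafBlock-complete true u xs block
leafShape-complete zero true u (false ∷ xs) (seg , _) = ⊥-elim (true≢false (sym (seg zero z≤n refl)))
leafShape-complete zero false u (x ∷ xs) (_ , block) = leafBlock-complete x u xs block
leafShape-complete (suc r) true u (true ∷ xs) (seg , block) =
  leafShape-complete r true u xs ((λ i le → seg (suc i) (s≤s le)) , block)
leafShape-complete (suc r) true u (false ∷ xs) (seg , _) = ⊥-elim (true≢false (sym (seg zero z≤n refl)))
leafShape-complete (suc r) false u (x ∷ xs) (seg , block) =
  leafShape-complete r x u xs ((λ i le → seg (suc i) (s≤s le)) , block)

Adj : ℕ → ℕ → ℕ → Set
Adj m a b = (suc a ≡ b × b < m) ⊎ (suc b ≡ a × a < m)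
          ⊎ (a ≡ m ∸ 1 × m ∸ 1 < b) ⊎ (b ≡ m ∸ 1 × m ∸ 1 < a)

T⇒≡true : ∀ {b} → T b → b ≡ true
T⇒≡true {true} _ = refl

≡true⇒T : ∀ {b} → b ≡ true → T b
≡true⇒T refl = _

adjacent⇒Adj : ∀ n m (x z : Fin n) → pathStar n m x z ≡ true → Adj m (toℕ x) (toℕ z)
adjacent⇒Adj n m x z e = decode (≡true⇒T e)
  where
  open Equivalence
  decode : T (pathStar n m x z) → Adj m (toℕ x) (toℕ z)
  decode t with to T-∨ t
  ... | inj₁ t₁ with to T-∧ t₁
  ...   | (neighbours , bounds) with to T-∧ bounds | to T-∨ neighbours
  ...     | (a<m , b<m) | inj₁ e₁ = inj₁ (≡ᵇ⇒≡ _ _ e₁ , <ᵇ⇒< _ _ b<m)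
  ...     | (a<m , b<m) | inj₂ e₂ = inj₂ (inj₁ (≡ᵇ⇒≡ _ _ e₂ , <ᵇ⇒< _ _ a<m))
  decode t | inj₂ t₂ with to T-∨ t₂
  ... | inj₁ t₃ = inj₂ (inj₂ (inj₁ (≡ᵇ⇒≡ _ _ (proj₁ (to T-∧ t₃)) , <ᵇ⇒< _ _ (proj₂ (to T-∧ t₃)))))
  ... | inj₂ t₄ = inj₂ (inj₂ (inj₂ (≡ᵇ⇒≡ _ _ (proj₁ (to T-∧ t₄)) , <ᵇ⇒< _ _ (proj₂ (to T-∧ t₄)))))

Adj⇒adjacent : ∀ n m (x z : Fin n) → Adj m (toℕ x) (toℕ z) → pathStar n m x z ≡ true
Adj⇒adjacent n m x z adj = T⇒≡true (encode adj)
  where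
  open Equivalence
  a : ℕ
  a = toℕ x
  b : ℕ
  b = toℕ z
  pathPart : Bool
  pathPart = ((suc a ≡ᵇ b) ∨ (suc b ≡ᵇ a)) ∧ (a <ᵇ m) ∧ (b <ᵇ m)
  centreFirst : Bool
  centreFirst = (a ≡ᵇ (m ∸ 1)) ∧ ((m ∸ 1) <ᵇ b)
  pathEdge : (T (suc a ≡ᵇ b) ⊎ T (suc b ≡ᵇ a)) → a < m → b < m → T (pathStar n m x z)
  pathEdge step a<m b<m = from T-∨ (inj₁ (from T-∧ (from T-∨ step , from T-∧ (<⇒<ᵇ a<m , <⇒<ᵇ b<m))))
  encode : Adj m a b → T (pathStar n m x z)
  encode (inj₁ (e , b<m)) = pathEdge (inj₁ (≡⇒≡ᵇ _ _ e)) (<-trans (subst (a <_) e ≤-refl) b<m) b<m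
  encode (inj₂ (inj₁ (e , a<m))) = pathEdge (inj₂ (≡⇒≡ᵇ _ _ e)) a<m (<-trans (subst (b <_) e ≤-refl) a<m)
  encode (inj₂ (inj₂ (inj₁ (e , lt)))) =
    from (T-∨ {pathPart}) (inj₂ (from T-∨ (inj₁ (from T-∧ (≡⇒≡ᵇ _ _ e , <⇒<ᵇ lt)))))
  encode (inj₂ (inj₂ (inj₂ (e , lt)))) =
    from (T-∨ {pathPart}) (inj₂ (from (T-∨ {centreFirst}) (inj₂ (from T-∧ (≡⇒≡ᵇ _ _ e , <⇒<ᵇ lt)))))

∨-true : ∀ a b → a ∨ b ≡ true → a ≡ true ⊎ b ≡ true
∨-true true b e = inj₁ refl
∨-true false b e = inj₂ e

or-witness : ∀ {A : Set} (p : A → Bool) xs → or (map p xs) ≡ true → Σ A λ a → p a ≡ true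
or-witness p [] ()
or-witness p (x ∷ xs) e with ∨-true _ _ e
... | inj₁ px = x , px
... | inj₂ rest = or-witness p xs rest

or-member : ∀ {A : Set} (p : A → Bool) {xs a} → a ∈ xs → p a ≡ true → or (map p xs) ≡ true
or-member p (here refl) pa rewrite pa = refl
or-member p {x ∷ xs} (there a∈) pa = trans (cong (p x ∨_) (or-member p a∈ pa)) (∨-zeroʳ (p x))

lookup-at : ∀ {k} (S : Vec Bool k) (i : Fin k) → lookup S i ≡ at S (toℕ i)
lookup-at (x ∷ S) fzero = refl
lookup-at (x ∷ S) (fsuc i) = lookup-at S i

sameSet-sound : ∀ {k} (R S : VSet k) → sameSet R S ≡ true → ∀ x → lookup R x ≡ lookup S x
sameSet-sound (true ∷ R) (true ∷ S) e fzero = refl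
sameSet-sound (false ∷ R) (false ∷ S) e fzero = refl
sameSet-sound (true ∷ R) (true ∷ S) e (fsuc x) = sameSet-sound R S e x
sameSet-sound (false ∷ R) (false ∷ S) e (fsuc x) = sameSet-sound R S e x
sameSet-sound (true ∷ R) (false ∷ S) () _
sameSet-sound (false ∷ R) (true ∷ S) () _

sameSet-complete : ∀ {k} (R S : VSet k) → (∀ x → lookup R x ≡ lookup S x) → sameSet R S ≡ true
sameSet-complete [] [] h = refl
sameSet-complete (r ∷ R) (s ∷ S) h with h fzero
sameSet-complete (true ∷ R) (.true ∷ S) h | refl = sameSet-complete R S (λ x → h (fsuc x))
sameSet-complete (false ∷ R) (.false ∷ S) h | refl = sameSet-complete R S (λ x → h (fsuc x))

module Reachability {n : ℕ} (G : Graph n) (S : VSet n) (v : Fin n) where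

  seed : VSet n
  seed = tabulate λ w → lookup S w ∧ (toℕ w ≡ᵇ toℕ v)

  stage : ℕ → VSet n
  stage t = iter t (step G S) seed

  stage-suc : ∀ t x → lookup (stage (suc t)) x
    ≡ lookup S x ∧ (lookup (stage t) x ∨ or (map (λ y → lookup (stage t) y ∧ G y x) (allFin n)))
  stage-suc t x = lookup∘tabulate _ x

  stage-invariant : (C : Fin n → Set) → C v →
    (∀ x z → C x → lookup S z ≡ true → G x z ≡ true → C z) →
    ∀ t x → lookup (stage t) x ≡ true → C x
  stage-invariant C Cv spread zero x x∈ rewrite lookup∘tabulate (λ w → lookup S w ∧ (toℕ w ≡ᵇ toℕ v)) x =
    subst C (sym (toℕ-injective (≡ᵇ⇒≡ _ _ (≡true⇒T (∧-conicalʳ _ _ x∈))))) Cv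
  stage-invariant C Cv spread (suc t) x x∈ rewrite stage-suc t x with ∨-true _ _ (∧-conicalʳ _ _ x∈)
  ... | inj₁ old = stage-invariant C Cv spread t x old
  ... | inj₂ new with or-witness _ (allFin n) new
  ...   | y , yx = spread y x (stage-invariant C Cv spread t y (∧-conicalˡ _ _ yx)) (∧-conicalˡ _ _ x∈) (∧-conicalʳ _ _ yx)

  stage⊆S : ∀ t x → lookup (stage t) x ≡ true → lookup S x ≡ true
  stage⊆S zero x x∈ rewrite lookup∘tabulate (λ w → lookup S w ∧ (toℕ w ≡ᵇ toℕ v)) x = ∧-conicalˡ _ _ x∈
  stage⊆S (suc t) x x∈ rewrite stage-suc t x = ∧-conicalˡ _ _ x∈

  seed∋v : lookup S v ≡ true → lookup (stage 0) v ≡ true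
  seed∋v v∈S rewrite lookup∘tabulate (λ w → lookup S w ∧ (toℕ w ≡ᵇ toℕ v)) v | v∈S = T⇒≡true (≡⇒≡ᵇ (toℕ v) (toℕ v) refl)

  stage-spread : ∀ t x z → lookup (stage t) x ≡ true → G x z ≡ true → lookup S z ≡ true →
                 lookup (stage (suc t)) z ≡ true
  stage-spread t x z x∈ xz z∈S rewrite stage-suc t z | z∈S =
    trans (cong (lookup (stage t) z ∨_)
                (or-member (λ y → lookup (stage t) y ∧ G y z) (∈-allFin x) (trans (cong (_∧ G x z) x∈) xz)))
          (∨-zeroʳ _)

  stage-grows : ∀ t x → lookup (stage t) x ≡ true → lookup (stage (suc t)) x ≡ true
  stage-grows t x x∈ rewrite stage-suc t x | stage⊆S t x x∈ | x∈ = refl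

  stage-mono : ∀ t t' x → t ≤ t' → lookup (stage t) x ≡ true → lookup (stage t') x ≡ true
  stage-mono t t' x t≤t' x∈ = subst (λ q → lookup (stage q) x ≡ true) (m∸n+n≡m t≤t') (later (t' ∸ t))
    where
    later : ∀ d → lookup (stage (d + t)) x ≡ true
    later zero = x∈
    later (suc d) = stage-grows (d + t) x (later d)

  subtree-invariant : isSubtreeAt G v S ≡ true → (C : Fin n → Set) → C v →
    (∀ x z → C x → lookup S z ≡ true → G x z ≡ true → C z) →
    ∀ x → lookup S x ≡ true → C x
  subtree-invariant sub C Cv spread x x∈S =
    stage-invariant C Cv spread n x (trans (sameSet-sound (stage n) S (∧-conicalʳ _ _ sub) x) x∈S)

  subtree-if-reached : lookup S v ≡ true → (∀ x → lookup S x ≡ true → lookup (stage n) x ≡ true) →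
    isSubtreeAt G v S ≡ true
  subtree-if-reached v∈S reached = trans (cong (_∧ sameSet (stage n) S) v∈S) (sameSet-complete (stage n) S same)
    where
    same : ∀ x → lookup (stage n) x ≡ lookup S x
    same x with lookup S x in x∈S
    ... | true = reached x x∈S
    ... | false with lookup (stage n) x in x∈R
    ...   | true = ⊥-elim (true≢false (trans (sym (stage⊆S n x x∈R)) x∈S))
    ...   | false = refl

product-shift : ∀ a d h' → h' * d + a * h' ≡ (a + d) * h'
product-shift = solve-∀

product-grows-inward : ∀ a d h' → a ≤ h' → a * (d + h') ≤ (a + d) * h'
product-grows-inward a d h' a≤h' = begin
  a * (d + h')    ≡⟨ *-distribˡ-+ a d h' ⟩
  a * d + a * h'  ≤⟨ +-monoˡ-≤ (a * h') (*-monoˡ-≤ d a≤h') ⟩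
  h' * d + a * h' ≡⟨ product-shift a d h' ⟩
  (a + d) * h'    ∎
  where open ≤-Reasoning

smaller-factor : ∀ x y h h' → x ≤ h → h ≤ h' → x + y ≡ h + h' → x * y ≤ h * h'
smaller-factor x y h h' x≤h h≤h' x+y≡ = subst (λ t → x * y ≤ t * h') (m+[n∸m]≡n x≤h)
  (subst (λ t → x * t ≤ (x + (h ∸ x)) * h') (sym y≡) (product-grows-inward x (h ∸ x) h' (≤-trans x≤h h≤h')))
  where
  y≡ : y ≡ (h ∸ x) + h'
  y≡ = +-cancelˡ-≡ x y _ (trans x+y≡ (trans (cong (_+ h') (sym (m+[n∸m]≡n x≤h))) (+-assoc x (h ∸ x) h')))

balanced-product-max : ∀ a b h h' → a + b ≡ h + h' → h ≤ h' → h' ≤ suc h → a * b ≤ h * h'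
balanced-product-max a b h h' sum h≤h' h'≤1+h with a ≤? h
... | yes a≤h = smaller-factor a b h h' a≤h h≤h' sum
... | no a≰h = subst (_≤ h * h') (*-comm b a) (smaller-factor b a h h' b≤h h≤h' (trans (+-comm b a) sum))
  where
  b≤h : b ≤ h
  b≤h = +-cancelˡ-≤ (suc h) b h (begin
    suc h + b ≤⟨ +-monoˡ-≤ b (≰⇒> a≰h) ⟩
    a + b     ≡⟨ sum ⟩
    h + h'    ≤⟨ +-monoʳ-≤ h h'≤1+h ⟩
    h + suc h ≡⟨ +-comm h (suc h) ⟩
    suc h + h ∎)
    where open ≤-Reasoning

balanced-split : ∀ T → 2 ≤ T → Σ ℕ λ V → Σ ℕ λ h' → suc V + h' ≡ T × suc V ≤ h' × h' ≤ suc (suc V)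
balanced-split (suc zero) (s≤s ())
balanced-split (suc (suc T)) _ =
  ⌊ T /2⌋ , ⌈ suc (suc T) /2⌉ , ⌊n/2⌋+⌈n/2⌉≡n (suc (suc T)) , ⌊n/2⌋≤⌈n/2⌉ (suc (suc T)) , ⌈n/2⌉≤1+⌊n/2⌋ (suc (suc T))
  where
  ⌈n/2⌉≤1+⌊n/2⌋ : ∀ m → ⌈ m /2⌉ ≤ suc ⌊ m /2⌋
  ⌈n/2⌉≤1+⌊n/2⌋ zero = z≤n
  ⌈n/2⌉≤1+⌊n/2⌋ (suc zero) = s≤s z≤n
  ⌈n/2⌉≤1+⌊n/2⌋ (suc (suc m)) = s≤s (⌈n/2⌉≤1+⌊n/2⌋ m)

double-≤ : ∀ h N → h + h ≤ suc (N + N) → h ≤ N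
double-≤ h N h+h≤ with h ≤? N
... | yes h≤N = h≤N
... | no h≰N = ⊥-elim (<⇒≱ (≤-trans (s≤s (≤-reflexive (sym (+-suc N N)))) (+-mono-≤ (≰⇒> h≰N) (≰⇒> h≰N))) h+h≤)

at⇒index : ∀ {k} (S : Vec Bool k) i → at S i ≡ true → Σ (Fin k) λ x → toℕ x ≡ i
at⇒index (x ∷ S) zero _ = fzero , refl
at⇒index (x ∷ S) (suc i) i∈ with at⇒index S i i∈
... | y , y≡i = fsuc y , cong suc y≡i

present≢absent : ∀ {k} (S : Vec Bool k) b p → at S b ≡ true → at S p ≡ false → ¬ b ≡ p
present≢absent S b p b∈ p∉ refl = true≢false (trans (sym b∈) p∉)

module PathStarSubtrees (c g : ℕ) where

  n : ℕ
  n = suc c + g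

  G : Graph n
  G = pathStar n (suc c)

  c<n : c < n
  c<n = s≤s (m≤m+n c g)

  root∈ : ∀ (w : Fin n) S → isSubtreeAt G w S ≡ true → at S (toℕ w) ≡ true
  root∈ w S sub = trans (sym (lookup-at S w)) (∧-conicalˡ _ _ sub)

  subtree-confined : ∀ (w : Fin n) S → isSubtreeAt G w S ≡ true → (C : ℕ → Set) → C (toℕ w) →
    (∀ a b → C a → at S b ≡ true → Adj (suc c) a b → C b) → ∀ i → at S i ≡ true → C i
  subtree-confined w S sub C Cw spread i i∈ with at⇒index S i i∈
  ... | x , refl = Reachability.subtree-invariant G S w sub (λ y → C (toℕ y)) Cw
      (λ y z Cy z∈ yz → spread (toℕ y) (toℕ z) Cy (trans (sym (lookup-at S z)) z∈) (adjacent⇒Adj n (suc c) y z yz))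
      x (trans (lookup-at S x) i∈)

  -- A missing path vertex p separates the smaller from the larger indices.
  below-gap : ∀ (S : VSet n) p → p ≤ c → at S p ≡ false →
    ∀ a b → a < p → at S b ≡ true → Adj (suc c) a b → b < p
  below-gap S p p≤c p∉ a b a<p b∈ (inj₁ (refl , _)) = ≤∧≢⇒< a<p (present≢absent S b p b∈ p∉)
  below-gap S p p≤c p∉ a b a<p b∈ (inj₂ (inj₁ (refl , _))) = <-trans (n<1+n b) a<p
  below-gap S p p≤c p∉ a b a<p b∈ (inj₂ (inj₂ (inj₁ (refl , _)))) = ⊥-elim (<⇒≱ a<p p≤c)
  below-gap S p p≤c p∉ a b a<p b∈ (inj₂ (inj₂ (inj₂ (_ , c<a)))) = ⊥-elim (<⇒≱ (<-trans c<a a<p) p≤c)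

  above-gap : ∀ (S : VSet n) p → p ≤ c → at S p ≡ false →
    ∀ a b → p < a → at S b ≡ true → Adj (suc c) a b → p < b
  above-gap S p p≤c p∉ a b p<a b∈ (inj₁ (refl , _)) = <-trans p<a (n<1+n a)
  above-gap S p p≤c p∉ a b p<a b∈ (inj₂ (inj₁ (refl , _))) =
    ≤∧≢⇒< (s≤s⁻¹ p<a) (λ p≡b → present≢absent S b p b∈ p∉ (sym p≡b))
  above-gap S p p≤c p∉ a b p<a b∈ (inj₂ (inj₂ (inj₁ (refl , c<b)))) = <-trans p<a c<b
  above-gap S p p≤c p∉ a b p<a b∈ (inj₂ (inj₂ (inj₂ (refl , _)))) =
    ≤∧≢⇒< p≤c (λ p≡b → present≢absent S b p b∈ p∉ (sym p≡b))

  path-convex : ∀ (w : Fin n) S → isSubtreeAt G w S ≡ true →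
    ∀ a p b → a ≤ p → p ≤ b → p ≤ c → at S a ≡ true → at S b ≡ true → at S p ≡ true
  path-convex w S sub a p b a≤p p≤b p≤c a∈ b∈ with at S p in p∉
  ... | true = refl
  ... | false with <-cmp (toℕ w) p
  ...   | tri< w<p _ _ = ⊥-elim (<⇒≱ (subtree-confined w S sub (_< p) w<p (below-gap S p p≤c p∉) b b∈) p≤b)
  ...   | tri≈ _ w≡p _ = ⊥-elim (present≢absent S (toℕ w) p (root∈ w S sub) p∉ w≡p)
  ...   | tri> _ _ p<w = ⊥-elim (<⇒≱ (subtree-confined w S sub (p <_) p<w (above-gap S p p≤c p∉) a a∈) a≤p)

  -- Without the centre, a pendant W is cut off from every other vertex.
  lone-pendant : ∀ (S : VSet n) W → c < W → at S c ≡ false →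
    ∀ a b → a ≡ W → at S b ≡ true → Adj (suc c) a b → b ≡ W
  lone-pendant S W c<W c∉ a b refl b∈ (inj₁ (refl , b<m)) = ⊥-elim (<⇒≱ b<m (s≤s (<⇒≤ c<W)))
  lone-pendant S W c<W c∉ a b refl b∈ (inj₂ (inj₁ (_ , a<m))) = ⊥-elim (<⇒≱ c<W (s≤s⁻¹ a<m))
  lone-pendant S W c<W c∉ a b refl b∈ (inj₂ (inj₂ (inj₁ (refl , _)))) = ⊥-elim (<-irrefl refl c<W)
  lone-pendant S W c<W c∉ a b refl b∈ (inj₂ (inj₂ (inj₂ (refl , _)))) = ⊥-elim (present≢absent S b b b∈ c∉ refl)

  subtree⇒pathShape : (w : Fin n) (e : ℕ) → toℕ w + e ≡ c →
    ∀ S → isSubtreeAt G w S ≡ true → pathShape (toℕ w) false e S ≡ true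
  subtree⇒pathShape w e w+e≡c S sub = pathShape-complete W false e S (leftSegment , root , armSegment , centreNeeded)
    where
    W : ℕ
    W = toℕ w
    root : at S W ≡ true
    root = root∈ w S sub
    leftSegment : ∀ i → i ≤ W → at (false ∷ S) i ≡ true → at (false ∷ S) (suc i) ≡ true
    leftSegment zero _ ()
    leftSegment (suc i) i<W i∈ =
      path-convex w S sub i (suc i) W (n≤1+n i) i<W (≤-trans i<W (subst (W ≤_) w+e≡c (m≤m+n W e))) i∈ root
    armSegment : ∀ j → suc j ≤ e → at S (W + suc j) ≡ true → at S (W + j) ≡ true
    armSegment j j<e b∈ = path-convex w S sub W (W + j) (W + suc j) (m≤m+n W j) (+-monoʳ-≤ W (n≤1+n j))
      (subst (W + j ≤_) w+e≡c (+-monoʳ-≤ W (<⇒≤ j<e))) root b∈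
    centreNeeded : ∀ j → e < j → at S (W + j) ≡ true → at S (W + e) ≡ true
    centreNeeded j e<j b∈ = path-convex w S sub W (W + e) (W + j) (m≤m+n W e) (+-monoʳ-≤ W (<⇒≤ e<j))
      (≤-reflexive w+e≡c) root b∈

  subtree⇒leafShape : (w : Fin n) (u : ℕ) → toℕ w ≡ suc c + u →
    ∀ S → isSubtreeAt G w S ≡ true → leafShape c false u S ≡ true
  subtree⇒leafShape w u w≡ S sub = leafShape-complete c false u S (pathSegment , othersNeedCentre , leaf)
    where
    W : ℕ
    W = toℕ w
    root : at S W ≡ true
    root = root∈ w S sub
    c<W : c < W
    c<W = subst (c <_) (sym w≡) (s≤s (m≤m+n c u))
    w≡c+1+u : W ≡ c + suc u
    w≡c+1+u = trans w≡ (sym (+-suc c u))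
    pathSegment : ∀ i → i ≤ c → at (false ∷ S) i ≡ true → at (false ∷ S) (suc i) ≡ true
    pathSegment zero _ ()
    pathSegment (suc i) i<c i∈ = path-convex w S sub i (suc i) W (n≤1+n i) (<⇒≤ (≤-<-trans i<c c<W)) i<c i∈ root
    othersNeedCentre : ∀ i → ¬ i ≡ u → at S (c + suc i) ≡ true → at S c ≡ true
    othersNeedCentre i i≢u x∈ with at S c in c∉
    ... | true = refl
    ... | false = ⊥-elim (i≢u (suc-injective (+-cancelˡ-≡ c _ _
                    (trans (subtree-confined w S sub (_≡ W) refl (lone-pendant S W c<W c∉) (c + suc i) x∈) w≡c+1+u))))
    leaf : at S (c + suc u) ≡ true
    leaf = subst (λ q → at S q ≡ true) w≡c+1+u root

  -- Reachability from a path vertex v inside a set S of path shape; every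
  -- member of S is reached by walking along the path and, for pendants,
  -- one more step from the centre.
  module ReachPathShape (v : Fin n) (e : ℕ) (v+e≡c : toℕ v + e ≡ c)
                        (S : VSet n) (spec : PathSpec (toℕ v) e (false ∷ S)) where
    open Reachability G S v

    V : ℕ
    V = toℕ v

    root : at S V ≡ true
    root = proj₁ (proj₂ spec)

    V≤c : V ≤ c
    V≤c = subst (V ≤_) v+e≡c (m≤m+n V e)

    ReachedBy : ℕ → ℕ → Set
    ReachedBy t i = ∀ (x : Fin n) → toℕ x ≡ i → lookup (stage t) x ≡ true

    reached-root : ReachedBy 0 V
    reached-root x x≡V = subst (λ y → lookup (stage 0) y ≡ true) (sym (toℕ-injective x≡V))
                                (seed∋v (trans (lookup-at S v) root))

    reached-spread : ∀ t i j → i < n → ReachedBy t i → Adj (suc c) i j → at S j ≡ true → ReachedBy (suc t) j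
    reached-spread t i j i<n reached-i adj j∈ z refl =
      stage-spread t y z (reached-i y (toℕ-fromℕ< i<n))
        (Adj⇒adjacent n (suc c) y z (subst (λ a → Adj (suc c) a (toℕ z)) (sym (toℕ-fromℕ< i<n)) adj))
        (trans (lookup-at S z) j∈)
      where
      y : Fin n
      y = fromℕ< i<n

    leftward : ∀ d i → i + d ≡ V → at S i ≡ true → ReachedBy d i
    leftward zero i i+0≡V _ = subst (ReachedBy 0) (sym (trans (sym (+-identityʳ i)) i+0≡V)) reached-root
    leftward (suc d) i i+d≡V i∈ =
      reached-spread d (suc i) i (≤-<-trans i<c c<n)
        (leftward d (suc i) (trans (sym (+-suc i d)) i+d≡V) (proj₁ spec (suc i) i<V i∈))
        (inj₂ (inj₁ (refl , s≤s i<c))) i∈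
      where
      i<V : suc i ≤ V
      i<V = ≤-trans (s≤s (m≤m+n i d)) (≤-reflexive (trans (sym (+-suc i d)) i+d≡V))
      i<c : suc i ≤ c
      i<c = ≤-trans i<V V≤c

    rightward : ∀ d i → V + d ≡ i → i ≤ c → at S i ≡ true → ReachedBy d i
    rightward zero i V+0≡i _ _ = subst (ReachedBy 0) (trans (sym (+-identityʳ V)) V+0≡i) reached-root
    rightward (suc d) i V+d≡i i≤c i∈ =
      reached-spread d (V + d) i (≤-<-trans prev≤c c<n)
        (rightward d (V + d) refl prev≤c (proj₁ (proj₂ (proj₂ spec)) d d<e (subst (λ q → at S q ≡ true) (sym V+d≡i) i∈)))
        (inj₁ (trans (sym (+-suc V d)) V+d≡i , s≤s i≤c)) i∈
      where
      prev≤c : V + d ≤ c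
      prev≤c = ≤-trans (+-monoʳ-≤ V (n≤1+n d)) (subst (_≤ c) (sym V+d≡i) i≤c)
      d<e : suc d ≤ e
      d<e = +-cancelˡ-≤ V (suc d) e (subst₂ _≤_ (sym V+d≡i) (sym v+e≡c) i≤c)

    pendantward : ∀ i → c < i → at S i ≡ true → ReachedBy (suc e) i
    pendantward i c<i i∈ =
      reached-spread e c i c<n (rightward e c v+e≡c ≤-refl centre) (inj₂ (inj₂ (inj₁ (refl , c<i)))) i∈
      where
      V≤i : V ≤ i
      V≤i = ≤-trans V≤c (<⇒≤ c<i)
      e<i-V : e < i ∸ V
      e<i-V = +-cancelˡ-< V e (i ∸ V) (subst₂ _<_ (sym v+e≡c) (sym (m+[n∸m]≡n V≤i)) c<i)
      centre : at S c ≡ true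
      centre = subst (λ q → at S q ≡ true) v+e≡c
        (proj₂ (proj₂ (proj₂ spec)) (i ∸ V) e<i-V (subst (λ q → at S q ≡ true) (sym (m+[n∸m]≡n V≤i)) i∈))

    later : ∀ {t i} → ReachedBy t i → t ≤ n → ReachedBy n i
    later reached-i t≤n x x≡i = stage-mono _ n x t≤n (reached-i x x≡i)

    reached-by-n : ∀ i → at S i ≡ true → ReachedBy n i
    reached-by-n i i∈ with ≤-total i V | i ≤? c
    ... | inj₁ i≤V | _ = later (leftward (V ∸ i) i (m+[n∸m]≡n i≤V) i∈)
                                 (≤-trans (m∸n≤m V i) (≤-trans V≤c (<⇒≤ c<n)))
    ... | inj₂ V≤i | yes i≤c = later (rightward (i ∸ V) i (m+[n∸m]≡n V≤i) i≤c i∈)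
                                     (≤-trans (m∸n≤m i V) (≤-trans i≤c (<⇒≤ c<n)))
    ... | inj₂ _ | no i≰c = later (pendantward i (≰⇒> i≰c) i∈)
                                  (≤-trans (s≤s (subst (e ≤_) v+e≡c (m≤n+m e V))) (m≤m+n (suc c) g))

  pathShape⇒subtree : (v : Fin n) (e : ℕ) → toℕ v + e ≡ c →
    ∀ S → pathShape (toℕ v) false e S ≡ true → isSubtreeAt G v S ≡ true
  pathShape⇒subtree v e v+e≡c S acc =
    Reachability.subtree-if-reached G S v (trans (lookup-at S v) root)
      (λ x x∈ → reached-by-n (toℕ x) (trans (sym (lookup-at S x)) x∈) x refl)
    where open ReachPathShape v e v+e≡c S (pathShape-sound (toℕ v) false e S acc)

  count-pathShape-at : (w : Fin n) (e : ℕ) → toℕ w + e ≡ c →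
    count n (pathShape (toℕ w) false e) ≡ suc (toℕ w) * (e + 2 ^ g)
  count-pathShape-at w e w+e≡c =
    subst (λ k → count k (pathShape (toℕ w) false e) ≡ suc (toℕ w) * (e + 2 ^ g))
          (cong suc (trans (sym (+-assoc (toℕ w) e g)) (cong (_+ g) w+e≡c)))
          (count-pathShape (toℕ w) e g)

  f-path-≤ : (w : Fin n) (e : ℕ) → toℕ w + e ≡ c → f G w ≤ suc (toℕ w) * (e + 2 ^ g)
  f-path-≤ w e w+e≡c = ≤-trans (count-mono n _ _ (subtree⇒pathShape w e w+e≡c))
                               (≤-reflexive (count-pathShape-at w e w+e≡c))

  f-path-≥ : (v : Fin n) (e : ℕ) → toℕ v + e ≡ c → suc (toℕ v) * (e + 2 ^ g) ≤ f G v
  f-path-≥ v e v+e≡c = ≤-trans (≤-reflexive (sym (count-pathShape-at v e v+e≡c)))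
                               (count-mono n _ _ (pathShape⇒subtree v e v+e≡c))

  -- f at a pendant: at most (c+1)·2^(g-1) + 1 ≤ (c+1)·2^g.
  f-pendant-≤ : (w : Fin n) → c < toℕ w → f G w ≤ suc c * 2 ^ g
  f-pendant-≤ w c<w = begin
    f G w                    ≤⟨ count-mono n _ _ (subtree⇒leafShape w u w≡) ⟩
    count n (leafShape c false u)
      ≡⟨ cong (λ k → count (suc c + k) (leafShape c false u)) g≡ ⟩
    count (suc c + (suc u + q)) (leafShape c false u)
      ≡⟨ count-leafShape c u q ⟩
    suc c * P + 1            ≤⟨ +-monoʳ-≤ (suc c * P) (≤-trans (m^n>0 2 (u + q)) (m≤m+n P (c * P))) ⟩
    suc c * P + suc c * P    ≡⟨ sym (*-distribˡ-+ (suc c) P P) ⟩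
    suc c * (P + P)          ≡⟨ cong (λ t → suc c * (P + t)) (sym (+-identityʳ P)) ⟩
    suc c * 2 ^ (suc u + q)  ≡⟨ cong (λ t → suc c * 2 ^ t) (sym g≡) ⟩
    suc c * 2 ^ g            ∎
    where
    open ≤-Reasoning
    u : ℕ
    u = toℕ w ∸ suc c
    w≡ : toℕ w ≡ suc c + u
    w≡ = sym (m+[n∸m]≡n c<w)
    u<g : suc u ≤ g
    u<g = +-cancelˡ-≤ (suc c) (suc u) g
            (subst (_≤ suc c + g) (trans (cong suc w≡) (sym (+-suc (suc c) u))) (toℕ<n w))
    q : ℕ
    q = g ∸ suc u
    g≡ : g ≡ suc u + q
    g≡ = sym (m+[n∸m]≡n u<g)
    P : ℕ
    P = 2 ^ (u + q)

  factor-sum : ∀ W → W ≤ c → suc W + ((c ∸ W) + 2 ^ g) ≡ suc c + 2 ^ g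
  factor-sum W W≤c = cong suc (trans (sym (+-assoc W (c ∸ W) (2 ^ g))) (cong (_+ 2 ^ g) (m+[n∸m]≡n W≤c)))

  -- A path vertex whose factors V+1 and (c∸V)+2^g are balanced lies in
  -- the subtree core: every path vertex has a less balanced factorisation,
  -- and every pendant is dominated by the factorisation (c+1)·2^g.
  balanced⇒core : (v : Fin n) {V : ℕ} → toℕ v ≡ V → V ≤ c →
    suc V ≤ (c ∸ V) + 2 ^ g → (c ∸ V) + 2 ^ g ≤ suc (suc V) → InSubtreeCore G v
  balanced⇒core v {V} refl V≤c balanced₁ balanced₂ w with toℕ w ≤? c
  ... | yes w≤c = begin
    f G w                                ≤⟨ f-path-≤ w (c ∸ toℕ w) (m+[n∸m]≡n w≤c) ⟩
    suc (toℕ w) * ((c ∸ toℕ w) + 2 ^ g)  ≤⟨ balanced-product-max (suc (toℕ w)) _ (suc V) _ equal-sums balanced₁ balanced₂ ⟩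
    suc V * ((c ∸ V) + 2 ^ g)            ≤⟨ f-path-≥ v (c ∸ V) (m+[n∸m]≡n V≤c) ⟩
    f G v                                ∎
    where
    open ≤-Reasoning
    equal-sums : suc (toℕ w) + ((c ∸ toℕ w) + 2 ^ g) ≡ suc V + ((c ∸ V) + 2 ^ g)
    equal-sums = trans (factor-sum (toℕ w) w≤c) (sym (factor-sum V V≤c))
  ... | no w≰c = begin
    f G w                      ≤⟨ f-pendant-≤ w (≰⇒> w≰c) ⟩
    suc c * 2 ^ g              ≤⟨ balanced-product-max (suc c) (2 ^ g) (suc V) _ (sym (factor-sum V V≤c)) balanced₁ balanced₂ ⟩
    suc V * ((c ∸ V) + 2 ^ g)  ≤⟨ f-path-≥ v (c ∸ V) (m+[n∸m]≡n V≤c) ⟩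
    f G v                      ∎
    where open ≤-Reasoning

  core-vertex : 2 ^ g ≤ suc c → Σ (Fin n) λ v → InSubtreeCore G v × suc (toℕ v) + suc (toℕ v) ≤ suc c + 2 ^ g
  core-vertex 2^g≤1+c with balanced-split (suc c + 2 ^ g) (s≤s (≤-trans (m^n>0 2 g) (m≤n+m (2 ^ g) c)))
  ... | V , h' , sum , balanced₁ , balanced₂ =
    v , balanced⇒core v (toℕ-fromℕ< V<n) V≤c (subst (suc V ≤_) h'≡ balanced₁) (subst (_≤ suc (suc V)) h'≡ balanced₂)
      , subst (λ t → suc t + suc t ≤ suc c + 2 ^ g) (sym (toℕ-fromℕ< V<n)) half
    where
    half : suc V + suc V ≤ suc c + 2 ^ g
    half = ≤-trans (+-monoʳ-≤ (suc V) balanced₁) (≤-reflexive sum)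
    V≤c : V ≤ c
    V≤c = s≤s⁻¹ (double-≤ (suc V) (suc c) (≤-trans half (m≤n⇒m≤1+n (+-monoʳ-≤ (suc c) 2^g≤1+c))))
    V<n : V < n
    V<n = s≤s (≤-trans V≤c (m≤m+n c g))
    v : Fin n
    v = fromℕ< V<n
    h'≡ : h' ≡ (c ∸ V) + 2 ^ g
    h'≡ = +-cancelˡ-≡ (suc V) h' _ (trans sum (sym (factor-sum V V≤c)))

pathStar-core : ∀ n m c g → n ≡ suc c + g → m ≡ suc c → 2 ^ g ≤ suc c →
  Σ (Fin n) λ v → InSubtreeCore (pathStar n m) v × suc (toℕ v) + suc (toℕ v) ≤ m + 2 ^ g
pathStar-core .(suc c + g) .(suc c) c g refl refl = PathStarSubtrees.core-vertex c g

-- k + A ≤ 2^k·A for positive A, since k+1 ≤ 2^k.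
k+A≤2^k*A : ∀ k A → 1 ≤ A → k + A ≤ 2 ^ k * A
k+A≤2^k*A k A 1≤A = begin
  k + A      ≤⟨ +-monoˡ-≤ A (≤-trans (≤-reflexive (sym (*-identityʳ k))) (*-monoʳ-≤ k 1≤A)) ⟩
  k * A + A  ≡⟨ +-comm (k * A) A ⟩
  suc k * A  ≤⟨ *-monoˡ-≤ A (1+k≤2^k k) ⟩
  2 ^ k * A  ∎
  where
  open ≤-Reasoning
  1+k≤2^k : ∀ k → suc k ≤ 2 ^ k
  1+k≤2^k zero = s≤s z≤n
  1+k≤2^k (suc k) = +-mono-≤ (m^n>0 2 k) (≤-trans (1+k≤2^k k) (≤-reflexive (sym (+-identityʳ _))))

-- Minimality of g0, applied at g0 - 1 = k + g, leaves room: k + 2^g ≤ n - g0.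
g0-room : ∀ n G k g → IsG0 n (suc G) → k + g ≡ G → 1 ≤ G → k + 2 ^ g ≤ n ∸ suc G
g0-room n G k g (_ , _ , minimal) k+g≡G 1≤G = ≤-trans (k+A≤2^k*A k (2 ^ g) (m^n>0 2 g)) (begin
  2 ^ k * 2 ^ g  ≡⟨ sym (^-distribˡ-+-* 2 k g) ⟩
  2 ^ (k + g)    ≡⟨ cong (2 ^_) k+g≡G ⟩
  2 ^ G          ≤⟨ suc[m]≤n⇒m≤pred[n] (subst (_≤ n ∸ G) (+-comm (2 ^ G) 1) (minimal G 1≤G ≤-refl)) ⟩
  pred (n ∸ G)   ≡⟨ pred[m∸n]≡m∸[1+n] n G ⟩
  n ∸ suc G      ∎)
  where open ≤-Reasoning

-- With c+1 = (n-g0) + k + 1 and g0 = k + 1 + g, the tree has c+1+g = n vertices.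
size-split : ∀ n G k g → k + g ≡ G → 1 ≤ n ∸ suc G → n ≡ suc (n ∸ suc G + k) + g
size-split n G k g k+g≡G 1≤N = begin
  n                      ≡⟨ sym (m∸n+n≡m (<⇒≤ (m∸n≢0⇒n<m {n} {suc G} (λ N≡0 → <⇒≱ 1≤N (≤-reflexive N≡0))))) ⟩
  N + suc G              ≡⟨ cong (λ t → N + suc t) (sym k+g≡G) ⟩
  N + suc (k + g)        ≡⟨ regroup N k g ⟩
  suc (N + k) + g        ∎
  where
  open ≡-Reasoning
  N : ℕ
  N = n ∸ suc G
  regroup : ∀ N k g → N + suc (k + g) ≡ suc (N + k) + g
  regroup = solve-∀

lemma3p2 : (n g0 : ℕ) → 5 ≤ n → IsG0 n g0 →
    (k : ℕ) → 1 ≤ k → k + 2 ≤ g0 →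
    ∃ λ (α : ℕ) → Σ (Fin n) λ v →
      (toℕ v + 1 + α ≡ n ∸ g0) × InSubtreeCore (pathStar n (n ∸ g0 + k)) v
lemma3p2 n (suc G) _ isG0 (suc k) _ (s≤s k+2≤G) = N ∸ suc V , v , index , proj₁ (proj₂ found)
  where
  N : ℕ
  N = n ∸ suc G
  g : ℕ
  g = G ∸ k
  k+g≡G : k + g ≡ G
  k+g≡G = m+[n∸m]≡n (≤-trans (m≤m+n k 2) k+2≤G)
  -- Here k stands for the paper's k - 1, and g = g0 - (k+1) is the star size.
  room : k + 2 ^ g ≤ N
  room = g0-room n G k g isG0 k+g≡G (≤-trans (n≤1+n 1) (≤-trans (m≤n+m 2 k) k+2≤G))
  found : Σ (Fin n) λ v → InSubtreeCore (pathStar n (N + suc k)) v × suc (toℕ v) + suc (toℕ v) ≤ N + suc k + 2 ^ g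
  found = pathStar-core n (N + suc k) (N + k) g
            (size-split n G k g k+g≡G (≤-trans (m^n>0 2 g) (≤-trans (m≤n+m (2 ^ g) k) room))) (+-suc N k)
            (≤-trans (m≤n+m (2 ^ g) k) (≤-trans room (m≤n⇒m≤1+n (m≤m+n N k))))
  v : Fin n
  v = proj₁ found
  V : ℕ
  V = toℕ v
  V<N : suc V ≤ N
  V<N = double-≤ (suc V) N (≤-trans (proj₂ (proj₂ found)) (begin
    N + suc k + 2 ^ g      ≡⟨ cong (_+ 2 ^ g) (+-suc N k) ⟩
    suc (N + k + 2 ^ g)    ≡⟨ cong suc (+-assoc N k (2 ^ g)) ⟩
    suc (N + (k + 2 ^ g))  ≤⟨ s≤s (+-monoʳ-≤ N room) ⟩
    suc (N + N)            ∎))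
    where open ≤-Reasoning
  -- α = N ∸ (V+1) places the core vertex V at n - g0 - α (1-based).
  index : V + 1 + (N ∸ suc V) ≡ N
  index = trans (cong (_+ (N ∸ suc V)) (+-comm V 1)) (m+[n∸m]≡n V<N)
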